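{- Let $k\ge2$, let $\mathcal H$ be a simple $k$-uniform hypergraph, and let $X=X_1\sqcup X_2$ be an infragraph of $\mathcal H$ which is the union of two vertex-disjoint infragraphs $X_1,X_2$ (i.e. $X=X_1+X_2$ and $V(X_1)\cap V(X_2)=\emptyset$). Then for every integer $n\ge0$, $$\Delta(n,X)=\Delta(n,X_1)\cdot\Delta(n,X_2).$$
   Context: A simple $k$-uniform hypergraph $\mathcal H$ has a finite vertex set and edge set $E(\mathcal H)$ consisting of $k$-element vertex subsets. An infragraph of $\mathcal H$ is a function $X:E(\mathcal H)\to\mathbb Z_{\ge0}$ with $\deg_X(v)=\sum_{e\ni v}X(e)$ divisible by $k$ for all vertices $v$, regarded as the multi-hypergraph with $X(e)$ parallel copies of $e$; $V(X)$ is the union of edges with $X(e)>0$; $X$ is connected if nonzero and $(V(X),\{e:X(e)>0\})$ is connected. A Veblen multi-hypergraph is a finite $k$-uniform multi-hypergraph (no isolated vertices) with all degrees divisible by $k$. For a connected one, $Y$, with vertex set $V$ and parallel classes $1,\dots,s$ (class $j$: $m_j$ edges on vertex set $\varepsilon_j$), a root assignment is a family $r_u(j)\in\mathbb Z_{\ge0}$ ($u\in\varepsilon_j$) with $\sum_{u\in\varepsilon_j}r_u(j)=m_j$; $r_u=\sum_jr_u(j)$; $D_r$ is the digraph on $V$ with $r_u(j)$ distinguishable arcs $u\to w$ for each $j$, $u\in\varepsilon_j$, $w\in\varepsilon_j\setminus\{u\}$. The associated coefficient is $C_Y=\sum_r\frac{\prod_ur_u!}{\prod_{u,j}r_u(j)!}\frac{\mathrm{ec}(D_r)}{\prod_v(\deg^-_{D_r}(v))!}$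 over $r$ with $D_r$ Eulerian, $\mathrm{ec}$ = number of Eulerian circuits (up to cyclic rotation). A decomposition of an infragraph $X$ is a finite multiset $\mathbf S=\{Y_1,\dots,Y_c\}$ of nonempty connected infragraphs with $\sum Y_i=X$; $c(\mathbf S)=c$, $C_{\mathbf S}=\prod C_{Y_i}$, $\alpha_{\mathbf S}=\prod_Y(\text{multiplicity of }Y\text{ in }\mathbf S)!$. For $n\ge0$, $\Delta(n,X)=\sum_{\mathbf S}(-(k-1)^n)^{c(\mathbf S)}C_{\mathbf S}/\alpha_{\mathbf S}$, the sum over all decompositions of $X$. -}

module Defs where

open import Data.Nat as ℕ using (ℕ; zero; suc; _≤_; _<_; _∸_; _!; _^_)
open import Data.Nat.Properties using (_!≢0)
open import Data.Nat.Divisibility using (_∣_; _∣?_)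
open import Data.Fin as F using (Fin; zero; suc)
open import Data.Fin.Properties using () renaming (_≟_ to _≟ᶠ_)
open import Data.Fin.Subset using (Subset; _∈_; ∣_∣; inside; outside)
open import Data.Vec as V using (Vec; []; _∷_)
open import Data.Vec.Functional as VF using ()
open import Data.List as L using (List; map; concatMap; filterᵇ; allFin; upTo; length; replicate; foldr)
open import Data.Nat.ListAction using (sum)
open import Data.Bool.ListAction using (all; any)
open import Data.Bool using (Bool; true; false; if_then_else_; _∧_; _∨_; not)
open import Data.Integer using (+_)
open import Data.Rational as Q using (ℚ; 0ℚ; 1ℚ)
open import Data.Product using (_×_; _,_; ∃)
open import Function using (_∘_)
open import Relation.Nullary.Decidable using (⌊_⌋)
open import Relation.Binary.PropositionalEquality using (_≡_)

Σℕ : ∀ {n} → (Fin n → ℕ) → ℕ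
Σℕ f = sum (map f (allFin _))

Σℚ : List ℚ → ℚ
Σℚ = foldr Q._+_ 0ℚ

Πℚ : ∀ {n} → (Fin n → ℚ) → ℚ
Πℚ f = foldr Q._*_ 1ℚ (map f (allFin _))

ℕ→ℚ : ℕ → ℚ
ℕ→ℚ n = + n Q./ 1

inv! : ℕ → ℚ
inv! n = (+ 1 Q./ (n !)) {{n !≢0}}

_^ℚ_ : ℚ → ℕ → ℚ
q ^ℚ zero  = 1ℚ
q ^ℚ suc n = q Q.* (q ^ℚ n)

_==ᶠ_ : ∀ {n} → Fin n → Fin n → Bool
i ==ᶠ j = ⌊ i ≟ᶠ j ⌋

isZero : ℕ → Bool
isZero zero    = true
isZero (suc _) = false

inE : ∀ {N} → Fin N → Subset N → Bool
inE v s = V.lookup s v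

allFuns : ∀ {A : Set} n → (Fin n → List A) → List (Fin n → A)
allFuns zero    F = L.[ (λ ()) ]
allFuns (suc n) F = concatMap (λ a → map (a VF.∷_) (allFuns n (F ∘ suc))) (F zero)

record Hypergraph (N k : ℕ) : Set where
  field
    nEdges  : ℕ
    edge    : Fin nEdges → Subset N
    uniform : ∀ e → ∣ edge e ∣ ≡ k
    simple  : ∀ e f → edge e ≡ edge f → e ≡ f
open Hypergraph public

EdgeFun : ∀ {N k} → Hypergraph N k → Set
EdgeFun H = Fin (nEdges H) → ℕ

_⊕_ : ∀ {N k} {H : Hypergraph N k} → EdgeFun H → EdgeFun H → EdgeFun H
(X ⊕ Y) e = X e ℕ.+ Y e

deg : ∀ {N k} (H : Hypergraph N k) → EdgeFun H → Fin N → ℕ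
deg H X v = Σℕ (λ e → if inE v (edge H e) then X e else 0)

IsInfragraph : ∀ {N k} (H : Hypergraph N k) → EdgeFun H → Set
IsInfragraph {k = k} H X = ∀ v → k ∣ deg H X v

_∈V[_]_ : ∀ {N k} → Fin N → (H : Hypergraph N k) → EdgeFun H → Set
v ∈V[ H ] X = ∃ λ e → 0 < X e × v ∈ edge H e

isInfragraphᵇ : ∀ {N k} (H : Hypergraph N k) → EdgeFun H → Bool
isInfragraphᵇ {k = k} H X = all (λ v → ⌊ k ∣? deg H X v ⌋) (allFin _)

inVᵇ : ∀ {N k} (H : Hypergraph N k) → EdgeFun H → Fin N → Bool
inVᵇ H X v = any (λ e → not (isZero (X e)) ∧ inE v (edge H e)) (allFin _)

reachStep : ∀ {N k} (H : Hypergraph N k) → EdgeFun H → (Fin N → Bool) → (Fin N → Bool)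
reachStep H X R w =
  R w ∨ any (λ e → not (isZero (X e)) ∧ inE w (edge H e)
                   ∧ any (λ u → R u ∧ inE u (edge H e)) (allFin _)) (allFin _)

iter : ∀ {A : Set} → ℕ → (A → A) → A → A
iter zero    f a = a
iter (suc n) f a = f (iter n f a)

-- vertices reachable from u by a walk of at most nEdges support edges
-- (a shortest walk never repeats an edge, so this is full reachability)
reach : ∀ {N k} (H : Hypergraph N k) → EdgeFun H → Fin N → Fin N → Bool
reach H X u = iter (nEdges H) (reachStep H X) (λ w → u ==ᶠ w)

isConnectedᵇ : ∀ {N k} (H : Hypergraph N k) → EdgeFun H → Bool
isConnectedᵇ H X =
  any (λ e → not (isZero (X e))) (allFin _)
  ∧ all (λ u → all (λ w → not (inVᵇ H X u ∧ inVᵇ H X w) ∨ reach H X u w)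
                   (allFin _)) (allFin _)

-- Eulerian circuits of a digraph given as a list of distinguishable arcs
-- (tail , head).

Arc : ℕ → Set
Arc N = Fin N × Fin N

select : ∀ {A : Set} {n} → Vec A (suc n) → List (A × Vec A n)
select {n = zero}  (x ∷ [])  = L.[ (x , []) ]
select {n = suc n} (x ∷ xs) =
  (x , xs) L.∷ map (λ p → Data.Product.proj₁ p , x ∷ Data.Product.proj₂ p) (select xs)
  where import Data.Product

trails : ∀ {N n} → Fin N → Fin N → Vec (Arc N) n → ℕ
trails {n = zero}  cur st [] = if cur ==ᶠ st then 1 else 0
trails {n = suc n} cur st as =
  sum (map (λ p → let a = Data.Product.proj₁ p in
                  if Data.Product.proj₁ a ==ᶠ cur
                  then trails (Data.Product.proj₂ a) st (Data.Product.proj₂ p)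
                  else 0) (select as))
  where import Data.Product

-- number of closed trails using every arc exactly once, as sequences
-- (a₁,…,a_A) (i.e. Eulerian circuits with a distinguished starting arc)
circuitSeqs : ∀ {N n} → Vec (Arc N) n → ℕ
circuitSeqs {n = zero}  [] = 1
circuitSeqs {n = suc n} as =
  sum (map (λ p → let a = Data.Product.proj₁ p in
                  trails (Data.Product.proj₂ a) (Data.Product.proj₁ a) (Data.Product.proj₂ p))
           (select as))
  where import Data.Product

-- Since arcs are
-- distinguishable, each rotation class of a circuit with A arcs has exactly
-- A members.  (The arc-less digraph never occurs below.)
ec : ∀ {N} → List (Arc N) → ℕ
ec as with length as | V.fromList as
... | zero  | _  = 1
... | suc A | vs = circuitSeqs vs ℕ./ suc A

indeg : ∀ {N} → List (Arc N) → Fin N → ℕ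
indeg as v = length (filterᵇ (λ a → Data.Product.proj₂ a ==ᶠ v) as)
  where import Data.Product

-- The coefficient C_Y of a connected Veblen multi-hypergraph Y, given as an
-- infragraph of H.  Since H is simple, the parallel classes of Y are the
-- edges e with Y(e) > 0, with m_e = Y(e) and ε_e = edge e.

comps : ∀ {N} → Subset N → ℕ → List (Fin N → ℕ)
comps []            zero    = L.[ (λ ()) ]
comps []            (suc _) = L.[]
comps (outside ∷ s) t = map (0 VF.∷_) (comps s t)
comps (inside ∷ s)  t =
  concatMap (λ i → map (i VF.∷_) (comps s (t ∸ i))) (upTo (suc t))

-- root assignments: r e u = r_u(e), zero unless u ∈ ε_e,
-- with Σ_{u ∈ ε_e} r_u(e) = m_e
RootAssignment : ∀ {N k} → Hypergraph N k → Set
RootAssignment {N} H = Fin (nEdges H) → Fin N → ℕ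

rootAssignments : ∀ {N k} (H : Hypergraph N k) → EdgeFun H → List (RootAssignment H)
rootAssignments H Y = allFuns (nEdges H) (λ e → comps (edge H e) (Y e))

rTot : ∀ {N k} (H : Hypergraph N k) → RootAssignment H → Fin N → ℕ
rTot H r u = Σℕ (λ e → r e u)

arcsOf : ∀ {N k} (H : Hypergraph N k) → RootAssignment H → List (Arc N)
arcsOf H r =
  concatMap (λ e → concatMap (λ u → concatMap (λ w →
      if inE u (edge H e) ∧ inE w (edge H e) ∧ not (u ==ᶠ w)
      then replicate (r e u) (u , w) else L.[])
    (allFin _)) (allFin _)) (allFin _)

isEulerianᵇ : ∀ {N k} (H : Hypergraph N k) → RootAssignment H → Bool
isEulerianᵇ H r = not (isZero (ec (arcsOf H r)))

-- summand:  (Π_u r_u!) / (Π_{u,j} r_u(j)!) · ec(D_r) / Π_v (deg⁻ v)!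
-- (products over all vertices/edges; the extra factors are 0! = 1)
coeffTerm : ∀ {N k} (H : Hypergraph N k) → RootAssignment H → ℚ
coeffTerm H r =
  Πℚ (λ u → ℕ→ℚ (rTot H r u !))
  Q.* Πℚ (λ u → Πℚ (λ e → inv! (r e u)))
  Q.* ℕ→ℚ (ec (arcsOf H r))
  Q.* Πℚ (λ v → inv! (indeg (arcsOf H r) v))

C : ∀ {N k} (H : Hypergraph N k) → EdgeFun H → ℚ
C H Y = Σℚ (map (coeffTerm H) (filterᵇ (isEulerianᵇ H) (rootAssignments H Y)))

candidates : ∀ {N k} (H : Hypergraph N k) → EdgeFun H → List (EdgeFun H)
candidates H X =
  filterᵇ (λ Y → isInfragraphᵇ H Y ∧ isConnectedᵇ H Y)
          (allFuns (nEdges H) (λ e → upTo (suc (X e))))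

-- A decomposition (finite multiset of nonempty connected infragraphs summing
-- to X) is encoded by its multiplicity function μ on the candidate list.
-- Multiplicities are bounded by Σ_e X(e) since each member is nonzero.
decompositions : ∀ {N k} (H : Hypergraph N k) (X : EdgeFun H) →
                 List (Fin (length (candidates H X)) → ℕ)
decompositions H X =
  filterᵇ (λ μ → all (λ e → ⌊ Σℕ (λ i → μ i ℕ.* L.lookup cs i e) ℕ.≟ X e ⌋)
                      (allFin _))
          (allFuns (length cs) (λ _ → upTo (suc (Σℕ X))))
  where cs = candidates H X

Δ : ∀ {N k} (H : Hypergraph N k) → ℕ → EdgeFun H → ℚ
Δ {k = k} H n X =
  Σℚ (map (λ μ → (Q.- ℕ→ℚ ((k ∸ 1) ^ n)) ^ℚ Σℕ μ
                 Q.* Πℚ (λ i → C H (L.lookup cs i) ^ℚ μ i)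
                 Q.* Πℚ (λ i → inv! (μ i)))
          (decompositions H X))
  where cs = candidates H X

-- Written as an iterated sum over all edge functions Y ≤ X, where non-components may only
-- occur with multiplicity 0, the sum no longer depends on the list of Y or on the bound for
-- the multiplicities as long as both are large enough; so Δ(n, X₁), Δ(n, X₂) and
-- Δ(n, X₁ + X₂) can all be computed over the same list. When X₁ and X₂ are vertex-disjoint,
-- every connected Y below X₁ + X₂ lies below X₁ or below X₂, so the constraint
-- Σ μ(Y)·Y = X₁ + X₂ splits into independent constraints for X₁ and X₂ and the iterated
-- sum factorises.

module Submission where

open import Defs
open import Data.Nat as ℕ using (ℕ; _≤_; zero; suc; _<_; z≤n; s≤s; _≤′_; ≤′-refl; ≤′-step)
open import Data.Fin using (Fin; zero; suc)
open import Data.Rational as ℚ using (ℚ; 0ℚ; 1ℚ; _+_; _*_)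
open import Data.Empty using (⊥; ⊥-elim)
open import Relation.Binary.PropositionalEquality
  using (_≡_; refl; sym; trans; cong; cong₂; subst; subst₂; module ≡-Reasoning)

open import Algebra.Bundles using (CommutativeMonoid)
open import Data.Bool using (Bool; true; false; if_then_else_; _∧_; _∨_; not; T)
open import Data.Bool.ListAction using (and; all; any)
import Data.Bool.Properties as BoolP
import Data.Fin.Properties as FinP
import Data.Fin.Subset as Subset
open import Data.Fin.Subset using (_∈_)
import Data.Fin.Subset.Properties as SubsetP
open import Data.List
  using (List; []; _∷_; _++_; _∷ʳ_; map; foldr; concatMap; filterᵇ; allFin; upTo; applyUpTo; tabulate; length; lookup)
import Data.List.Properties as ListP
import Data.Nat.Properties as ℕP
open import Data.Nat.ListAction using (sum)
open import Data.Product using (_×_; _,_; ∃; proj₁; proj₂)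
import Data.Rational.Properties as ℚP
open import Data.Sum using (_⊎_; inj₁; inj₂; [_,_]′; swap)
open import Data.Unit using (tt)
import Data.Vec.Functional as VF
import Data.Vec.Properties as VecP
open import Function using (_∘_; id; mk⇔)
open import Relation.Nullary.Decidable using (Dec; ⌊_⌋; yes; no; _→-dec_; decidable-stable; T?)

open import Algebra.Properties.CommutativeSemigroup
  (CommutativeMonoid.commutativeSemigroup ℚP.*-1-commutativeMonoid)
  using (x∙yz≈y∙xz) renaming (interchange to *-interchange)
open import Algebra.Properties.CommutativeSemigroup ℕP.+-commutativeSemigroup
  using (xy∙z≈xz∙y)

Σℚ-++ : (xs ys : List ℚ) → Σℚ (xs ++ ys) ≡ Σℚ xs + Σℚ ys
Σℚ-++ []       ys = sym (ℚP.+-identityˡ _)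
Σℚ-++ (x ∷ xs) ys = trans (cong (x +_) (Σℚ-++ xs ys)) (sym (ℚP.+-assoc x _ _))

module _ {A : Set} where

  Σℚ-map-cong : ∀ {f g : A → ℚ} (xs : List A) → (∀ x → f x ≡ g x) →
                Σℚ (map f xs) ≡ Σℚ (map g xs)
  Σℚ-map-cong xs f≗g = cong Σℚ (ListP.map-cong f≗g xs)

  Σℚ-map-zero : ∀ {f : A → ℚ} (xs : List A) → (∀ x → f x ≡ 0ℚ) → Σℚ (map f xs) ≡ 0ℚ
  Σℚ-map-zero []       f≡0 = refl
  Σℚ-map-zero (x ∷ xs) f≡0 = cong₂ _+_ (f≡0 x) (Σℚ-map-zero xs f≡0)

  Σℚ-map-*ˡ : ∀ c (f : A → ℚ) (xs : List A) → Σℚ (map (λ x → c * f x) xs) ≡ c * Σℚ (map f xs)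
  Σℚ-map-*ˡ c f []       = sym (ℚP.*-zeroʳ c)
  Σℚ-map-*ˡ c f (x ∷ xs) =
    trans (cong (c * f x +_) (Σℚ-map-*ˡ c f xs)) (sym (ℚP.*-distribˡ-+ c (f x) _))

  Σℚ-map-*ʳ : ∀ c (f : A → ℚ) (xs : List A) → Σℚ (map (λ x → f x * c) xs) ≡ Σℚ (map f xs) * c
  Σℚ-map-*ʳ c f []       = sym (ℚP.*-zeroˡ c)
  Σℚ-map-*ʳ c f (x ∷ xs) =
    trans (cong (f x * c +_) (Σℚ-map-*ʳ c f xs)) (sym (ℚP.*-distribʳ-+ c (f x) _))

  Σℚ-map-filterᵇ : ∀ (f : A → ℚ) (p : A → Bool) (xs : List A) →
                   Σℚ (map f (filterᵇ p xs)) ≡ Σℚ (map (λ x → if p x then f x else 0ℚ) xs)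
  Σℚ-map-filterᵇ f p []       = refl
  Σℚ-map-filterᵇ f p (x ∷ xs) with p x
  ... | true  = cong (f x +_) (Σℚ-map-filterᵇ f p xs)
  ... | false = trans (Σℚ-map-filterᵇ f p xs) (sym (ℚP.+-identityˡ _))

Σℚ-map-concatMap : ∀ {A B : Set} (f : B → ℚ) (g : A → List B) (xs : List A) →
                   Σℚ (map f (concatMap g xs)) ≡ Σℚ (map (λ x → Σℚ (map f (g x))) xs)
Σℚ-map-concatMap f g []       = refl
Σℚ-map-concatMap f g (x ∷ xs) = begin
  Σℚ (map f (g x ++ concatMap g xs))                ≡⟨ cong Σℚ (ListP.map-++ f (g x) _) ⟩
  Σℚ (map f (g x) ++ map f (concatMap g xs))        ≡⟨ Σℚ-++ (map f (g x)) _ ⟩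
  Σℚ (map f (g x)) + Σℚ (map f (concatMap g xs))    ≡⟨ cong (Σℚ (map f (g x)) +_) (Σℚ-map-concatMap f g xs) ⟩
  Σℚ (map f (g x)) + Σℚ (map (λ x → Σℚ (map f (g x))) xs) ∎
  where open ≡-Reasoning

Σℚ-upTo-suc : ∀ (f : ℕ → ℚ) n → Σℚ (map f (upTo (suc n))) ≡ Σℚ (map f (upTo n)) + f n
Σℚ-upTo-suc f n = begin
  Σℚ (map f (upTo (suc n)))                  ≡⟨ cong (Σℚ ∘ map f) (sym (ListP.upTo-∷ʳ n)) ⟩
  Σℚ (map f (upTo n ∷ʳ n))                  ≡⟨ cong Σℚ (ListP.map-++ f (upTo n) _) ⟩
  Σℚ (map f (upTo n) ++ f n ∷ [])            ≡⟨ Σℚ-++ (map f (upTo n)) _ ⟩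
  Σℚ (map f (upTo n)) + (f n + 0ℚ)           ≡⟨ cong (Σℚ (map f (upTo n)) +_) (ℚP.+-identityʳ (f n)) ⟩
  Σℚ (map f (upTo n)) + f n                  ∎
  where open ≡-Reasoning

Σℚ-upTo-head : ∀ (f : ℕ → ℚ) R → (∀ a → f (suc a) ≡ 0ℚ) → Σℚ (map f (upTo (suc R))) ≡ f 0
Σℚ-upTo-head f R f≡0 = begin
  f 0 + Σℚ (map f (applyUpTo suc R))     ≡⟨ cong (λ xs → f 0 + Σℚ xs) (ListP.map-applyUpTo suc f R) ⟩
  f 0 + Σℚ (applyUpTo (f ∘ suc) R)       ≡⟨ cong (λ xs → f 0 + Σℚ xs) (sym (ListP.map-upTo (f ∘ suc) R)) ⟩
  f 0 + Σℚ (map (f ∘ suc) (upTo R))      ≡⟨ cong (f 0 +_) (Σℚ-map-zero (upTo R) f≡0) ⟩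
  f 0 + 0ℚ                               ≡⟨ ℚP.+-identityʳ (f 0) ⟩
  f 0                                    ∎
  where open ≡-Reasoning

Σℚ-upTo-extend : ∀ (f : ℕ → ℚ) {R R'} → (∀ a → R < a → f a ≡ 0ℚ) → R ≤ R' →
                 Σℚ (map f (upTo (suc R))) ≡ Σℚ (map f (upTo (suc R')))
Σℚ-upTo-extend f {R} vanish R≤R' = extend (ℕP.≤⇒≤′ R≤R')
  where
  open ≡-Reasoning
  extend : ∀ {R'} → R ≤′ R' → Σℚ (map f (upTo (suc R))) ≡ Σℚ (map f (upTo (suc R')))
  extend ≤′-refl                  = refl
  extend (≤′-step {R'} R≤′R') = begin
    Σℚ (map f (upTo (suc R)))                   ≡⟨ extend R≤′R' ⟩
    Σℚ (map f (upTo (suc R')))                  ≡⟨ sym (ℚP.+-identityʳ _) ⟩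
    Σℚ (map f (upTo (suc R'))) + 0ℚ             ≡⟨ cong (Σℚ (map f (upTo (suc R'))) +_) (sym f[1+R']≡0) ⟩
    Σℚ (map f (upTo (suc R'))) + f (suc R')     ≡⟨ sym (Σℚ-upTo-suc f (suc R')) ⟩
    Σℚ (map f (upTo (suc (suc R'))))            ∎
    where f[1+R']≡0 = vanish (suc R') (s≤s (ℕP.≤′⇒≤ R≤′R'))

map-allFin-suc : ∀ {B : Set} {n} (f : Fin (suc n) → B) →
                 map f (allFin (suc n)) ≡ f zero ∷ map (f ∘ suc) (allFin n)
map-allFin-suc f =
  cong (f zero ∷_) (trans (ListP.map-tabulate suc f) (sym (ListP.map-tabulate id (f ∘ suc))))

Σℕ-suc : ∀ {n} (f : Fin (suc n) → ℕ) → Σℕ f ≡ f zero ℕ.+ Σℕ (f ∘ suc)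
Σℕ-suc f = cong sum (map-allFin-suc f)

Πℚ-suc : ∀ {n} (f : Fin (suc n) → ℚ) → Πℚ f ≡ f zero * Πℚ (f ∘ suc)
Πℚ-suc f = cong (foldr _*_ 1ℚ) (map-allFin-suc f)

≤Σℕ : ∀ {n} (f : Fin n → ℕ) (i : Fin n) → f i ≤ Σℕ f
≤Σℕ f zero    rewrite Σℕ-suc f = ℕP.m≤m+n _ _
≤Σℕ f (suc i) rewrite Σℕ-suc f = ℕP.≤-trans (≤Σℕ (f ∘ suc) i) (ℕP.m≤n+m _ _)

Πℚ-* : ∀ {n} (f g : Fin n → ℚ) → Πℚ (λ i → f i * g i) ≡ Πℚ f * Πℚ g
Πℚ-* {zero}  f g = refl
Πℚ-* {suc n} f g = begin
  Πℚ (λ i → f i * g i)                                       ≡⟨ Πℚ-suc (λ i → f i * g i) ⟩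
  (f zero * g zero) * Πℚ (λ i → f (suc i) * g (suc i))       ≡⟨ cong ((f zero * g zero) *_) (Πℚ-* (f ∘ suc) (g ∘ suc)) ⟩
  (f zero * g zero) * (Πℚ (f ∘ suc) * Πℚ (g ∘ suc))          ≡⟨ *-interchange (f zero) (g zero) _ _ ⟩
  (f zero * Πℚ (f ∘ suc)) * (g zero * Πℚ (g ∘ suc))          ≡⟨ sym (cong₂ _*_ (Πℚ-suc f) (Πℚ-suc g)) ⟩
  Πℚ f * Πℚ g                                                ∎
  where open ≡-Reasoning

^ℚ-+ : ∀ (q : ℚ) a b → q ^ℚ (a ℕ.+ b) ≡ q ^ℚ a * q ^ℚ b
^ℚ-+ q zero    b = sym (ℚP.*-identityˡ _)
^ℚ-+ q (suc a) b = trans (cong (q *_) (^ℚ-+ q a b)) (sym (ℚP.*-assoc q _ _))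

^ℚ-Σℕ : ∀ (q : ℚ) {n} (μ : Fin n → ℕ) → q ^ℚ Σℕ μ ≡ Πℚ (λ i → q ^ℚ μ i)
^ℚ-Σℕ q {zero}  μ = refl
^ℚ-Σℕ q {suc n} μ = begin
  q ^ℚ Σℕ μ                                 ≡⟨ cong (q ^ℚ_) (Σℕ-suc μ) ⟩
  q ^ℚ (μ zero ℕ.+ Σℕ (μ ∘ suc))            ≡⟨ ^ℚ-+ q (μ zero) _ ⟩
  q ^ℚ μ zero * q ^ℚ Σℕ (μ ∘ suc)           ≡⟨ cong (q ^ℚ μ zero *_) (^ℚ-Σℕ q (μ ∘ suc)) ⟩
  q ^ℚ μ zero * Πℚ (λ i → q ^ℚ μ (suc i))   ≡⟨ sym (Πℚ-suc (λ i → q ^ℚ μ i)) ⟩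
  Πℚ (λ i → q ^ℚ μ i)                       ∎
  where open ≡-Reasoning

module _ {A : Set} (p : A → Bool) where

  all-tabulate⁻ : ∀ {n} (f : Fin n → A) → all p (tabulate f) ≡ true → ∀ i → p (f i) ≡ true
  all-tabulate⁻ f all≡true zero    = BoolP.∧-conicalˡ _ _ all≡true
  all-tabulate⁻ f all≡true (suc i) = all-tabulate⁻ (f ∘ suc) (BoolP.∧-conicalʳ _ _ all≡true) i

  all-tabulate⁺ : ∀ {n} (f : Fin n → A) → (∀ i → p (f i) ≡ true) → all p (tabulate f) ≡ true
  all-tabulate⁺ {zero}  f p≡true = refl
  all-tabulate⁺ {suc n} f p≡true rewrite p≡true zero = all-tabulate⁺ (f ∘ suc) (p≡true ∘ suc)

  any-tabulate⁻ : ∀ {n} (f : Fin n → A) → any p (tabulate f) ≡ true → ∃ λ i → p (f i) ≡ true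
  any-tabulate⁻ {suc n} f any≡true with p (f zero) in p0
  ... | true  = zero , p0
  ... | false = let i , pi = any-tabulate⁻ (f ∘ suc) any≡true in suc i , pi

  any-tabulate⁺ : ∀ {n} (f : Fin n → A) i → p (f i) ≡ true → any p (tabulate f) ≡ true
  any-tabulate⁺ f zero    pi rewrite pi = refl
  any-tabulate⁺ f (suc i) pi with p (f zero)
  ... | true  = refl
  ... | false = any-tabulate⁺ (f ∘ suc) i pi

ℕ^ : ℕ → Set
ℕ^ E = Fin E → ℕ

0ᵛ : ∀ {E} → ℕ^ E
0ᵛ _ = 0

_+ᵛ_ : ∀ {E} → ℕ^ E → ℕ^ E → ℕ^ E
(u +ᵛ v) e = u e ℕ.+ v e

_+[_]·_ : ∀ {E} → ℕ^ E → ℕ → ℕ^ E → ℕ^ E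
(u +[ a ]· v) e = u e ℕ.+ a ℕ.* v e

_≤ᵛ_ : ∀ {E} → ℕ^ E → ℕ^ E → Set
u ≤ᵛ v = ∀ e → u e ≤ v e

_≰ᵛ_ : ∀ {E} → ℕ^ E → ℕ^ E → Set
u ≰ᵛ v = ∃ λ e → v e < u e

_≼_ : ∀ {E} → ℕ^ E → ℕ^ E → Set
u ≼ v = ∀ e → v e ≡ 0 → u e ≡ 0

_≡ᵇ_ : ∀ {E} → ℕ^ E → ℕ^ E → Bool
u ≡ᵇ v = all (λ e → ⌊ u e ℕ.≟ v e ⌋) (allFin _)

linComb : ∀ {E} (Ys : List (ℕ^ E)) → (Fin (length Ys) → ℕ) → ℕ^ E
linComb Ys μ e = Σℕ (λ i → μ i ℕ.* lookup Ys i e)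

allBelow : ∀ {E} → ℕ^ E → List (ℕ^ E)
allBelow {E} X = allFuns E (λ e → upTo (suc (X e)))

module _ {E : ℕ} where

  ≡ᵇ-sound : ∀ {u v : ℕ^ E} → u ≡ᵇ v ≡ true → ∀ e → u e ≡ v e
  ≡ᵇ-sound {u} {v} u≡ᵇv e with u e ℕ.≟ v e | all-tabulate⁻ (λ e → ⌊ u e ℕ.≟ v e ⌋) id u≡ᵇv e
  ... | yes ue≡ve | _ = ue≡ve

  ≡ᵇ-complete : ∀ {u v : ℕ^ E} → (∀ e → u e ≡ v e) → u ≡ᵇ v ≡ true
  ≡ᵇ-complete {u} {v} u≗v = all-tabulate⁺ (λ e → ⌊ u e ℕ.≟ v e ⌋) id ≟-true
    where
    ≟-true : ∀ e → ⌊ u e ℕ.≟ v e ⌋ ≡ true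
    ≟-true e with u e ℕ.≟ v e
    ... | yes _     = refl
    ... | no ue≢ve = ⊥-elim (ue≢ve (u≗v e))

  ≡ᵇ-congˡ : ∀ {u u' v : ℕ^ E} → (∀ e → u e ≡ u' e) → (u ≡ᵇ v) ≡ (u' ≡ᵇ v)
  ≡ᵇ-congˡ {v = v} u≗u' =
    cong and (ListP.map-cong (λ e → cong (λ n → ⌊ n ℕ.≟ v e ⌋) (u≗u' e)) (allFin _))

  Σℕ-mono-≤ᵛ : ∀ {u v : ℕ^ E} → u ≤ᵛ v → Σℕ u ≤ Σℕ v
  Σℕ-mono-≤ᵛ {u} {v} u≤v = go E u v u≤v
    where
    go : ∀ n (u v : Fin n → ℕ) → (∀ e → u e ≤ v e) → Σℕ u ≤ Σℕ v
    go zero    u v u≤v = z≤n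
    go (suc n) u v u≤v rewrite Σℕ-suc u | Σℕ-suc v =
      ℕP.+-mono-≤ (u≤v zero) (go n (u ∘ suc) (v ∘ suc) (u≤v ∘ suc))

  ≰ᵛ-antitone : ∀ {u v v' : ℕ^ E} → v' ≤ᵛ v → u ≰ᵛ v → u ≰ᵛ v'
  ≰ᵛ-antitone v'≤v (e , ve<ue) = e , ℕP.≤-<-trans (v'≤v e) ve<ue

  +[]·-≼ : ∀ {u Y X : ℕ^ E} a → u ≼ X → Y ≼ X → (u +[ a ]· Y) ≼ X
  +[]·-≼ {u} {Y} a u≼X Y≼X e Xe≡0 =
    trans (cong₂ (λ m n → m ℕ.+ a ℕ.* n) (u≼X e Xe≡0) (Y≼X e Xe≡0)) (ℕP.*-zeroʳ a)

  ≼-disjoint⇒≰ᵛ : ∀ {X₁ X₂ Y : ℕ^ E} → (∀ e → X₁ e ≡ 0 ⊎ X₂ e ≡ 0) →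
                  (∃ λ e → 0 < Y e) → Y ≼ X₁ → Y ≰ᵛ X₂
  ≼-disjoint⇒≰ᵛ {X₁} {X₂} disjoint (e , 0<Ye) Y≼X₁ with disjoint e
  ... | inj₁ X₁e≡0 = ⊥-elim (ℕP.<⇒≢ 0<Ye (sym (Y≼X₁ e X₁e≡0)))
  ... | inj₂ X₂e≡0 = e , subst (_< _) (sym X₂e≡0) 0<Ye

  ≡ᵇ-+ᵛ : ∀ {X₁ X₂ u₁ u₂ : ℕ^ E} → (∀ e → X₁ e ≡ 0 ⊎ X₂ e ≡ 0) → u₁ ≼ X₁ → u₂ ≼ X₂ →
          (u₁ +ᵛ u₂) ≡ᵇ (X₁ +ᵛ X₂) ≡ (u₁ ≡ᵇ X₁ ∧ u₂ ≡ᵇ X₂)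
  ≡ᵇ-+ᵛ {X₁} {X₂} {u₁} {u₂} disjoint u₁≼X₁ u₂≼X₂ = BoolP.⇔→≡ (mk⇔ split join)
    where
    split-at : ∀ e → u₁ e ℕ.+ u₂ e ≡ X₁ e ℕ.+ X₂ e → u₁ e ≡ X₁ e × u₂ e ≡ X₂ e
    split-at e sum≡ with disjoint e
    ... | inj₁ X₁e≡0 rewrite X₁e≡0 | u₁≼X₁ e X₁e≡0 = refl , sum≡
    ... | inj₂ X₂e≡0 rewrite X₂e≡0 | u₂≼X₂ e X₂e≡0 =
      trans (sym (ℕP.+-identityʳ (u₁ e))) (trans sum≡ (ℕP.+-identityʳ (X₁ e))) , refl
    split : (u₁ +ᵛ u₂) ≡ᵇ (X₁ +ᵛ X₂) ≡ true → (u₁ ≡ᵇ X₁ ∧ u₂ ≡ᵇ X₂) ≡ true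
    split u≡ᵇX = cong₂ _∧_ (≡ᵇ-complete (proj₁ ∘ parts)) (≡ᵇ-complete (proj₂ ∘ parts))
      where parts = λ e → split-at e (≡ᵇ-sound u≡ᵇX e)
    join : (u₁ ≡ᵇ X₁ ∧ u₂ ≡ᵇ X₂) ≡ true → (u₁ +ᵛ u₂) ≡ᵇ (X₁ +ᵛ X₂) ≡ true
    join both = ≡ᵇ-complete λ e → cong₂ ℕ._+_ (≡ᵇ-sound (BoolP.∧-conicalˡ _ _ both) e)
                                               (≡ᵇ-sound (BoolP.∧-conicalʳ _ _ both) e)

  ≼-+ᵛ⁻ : ∀ {Y : ℕ^ E} X₁ X₂ → Y ≼ (X₁ +ᵛ X₂) → ∀ {e} → 0 < Y e → 0 < X₁ e ⊎ 0 < X₂ e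
  ≼-+ᵛ⁻ {Y} X₁ X₂ Y≼X {e} 0<Ye with X₁ e in X₁e≡ | X₂ e in X₂e≡
  ... | suc _ | _     = inj₁ ℕP.0<1+n
  ... | zero  | suc _ = inj₂ ℕP.0<1+n
  ... | zero  | zero  = ⊥-elim (ℕP.<⇒≢ 0<Ye (sym (Y≼X e (cong₂ ℕ._+_ X₁e≡ X₂e≡))))

  ≼⊎escapes : (u v : ℕ^ E) → u ≼ v ⊎ ∃ λ e → 0 < u e × v e ≡ 0
  ≼⊎escapes u v = decide (FinP.all? implication?)
    where
    implication? : ∀ e → Dec (v e ≡ 0 → u e ≡ 0)
    implication? e = (v e ℕ.≟ 0) →-dec (u e ℕ.≟ 0)
    decide : Dec (u ≼ v) → u ≼ v ⊎ ∃ λ e → 0 < u e × v e ≡ 0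
    decide (yes u≼v) = inj₁ u≼v
    decide (no  u⋠v) =
      let e , ¬[ve≡0→ue≡0] = FinP.¬∀⟶∃¬ E _ implication? u⋠v
      in inj₂ (e , ℕP.n≢0⇒n>0 (λ ue≡0 → ¬[ve≡0→ue≡0] (λ _ → ue≡0))
                 , decidable-stable (v e ℕ.≟ 0) (λ ve≢0 → ¬[ve≡0→ue≡0] (⊥-elim ∘ ve≢0)))

data Pruned {A : Set} (P : A → Set) : List A → List A → Set where
  []   : Pruned P [] []
  keep : ∀ {xs ys} y → Pruned P xs ys → Pruned P (y ∷ xs) (y ∷ ys)
  drop : ∀ {xs ys} y → P y → Pruned P xs ys → Pruned P xs (y ∷ ys)

module _ {A : Set} {P : A → Set} where

  Pruned-++ : ∀ {xs ys xs' ys'} → Pruned P xs ys → Pruned P xs' ys' → Pruned P (xs ++ xs') (ys ++ ys')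
  Pruned-++ []             p' = p'
  Pruned-++ (keep y p)     p' = keep y (Pruned-++ p p')
  Pruned-++ (drop y Py p)  p' = drop y Py (Pruned-++ p p')

  Pruned-[] : ∀ {B : Set} (f : B → A) (xs : List B) → (∀ x → P (f x)) → Pruned P [] (map f xs)
  Pruned-[] f []       P∘f = []
  Pruned-[] f (x ∷ xs) P∘f = drop (f x) (P∘f x) (Pruned-[] f xs P∘f)

  Pruned-concatMap-upTo : ∀ (f g : ℕ → List A) {m m'} →
                          (∀ a → Pruned P (f a) (g a)) → (∀ a → m < a → Pruned P [] (g a)) → m ≤ m' →
                          Pruned P (concatMap f (upTo (suc m))) (concatMap g (upTo (suc m')))
  Pruned-concatMap-upTo f g {m} f⊑g g⊑[] m≤m' = extend (ℕP.≤⇒≤′ m≤m')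
    where
    same : ∀ xs → Pruned P (concatMap f xs) (concatMap g xs)
    same []       = []
    same (a ∷ xs) = Pruned-++ (f⊑g a) (same xs)
    extend : ∀ {m'} → m ≤′ m' → Pruned P (concatMap f (upTo (suc m))) (concatMap g (upTo (suc m')))
    extend ≤′-refl               = same (upTo (suc m))
    extend (≤′-step {m'} m≤′m') =
      subst₂ (Pruned P) (ListP.++-identityʳ _) g-split
        (Pruned-++ (extend m≤′m') (Pruned-++ (g⊑[] (suc m') (s≤s (ℕP.≤′⇒≤ m≤′m'))) []))
      where
      g-split : concatMap g (upTo (suc m')) ++ g (suc m') ++ [] ≡ concatMap g (upTo (suc (suc m')))
      g-split = trans (sym (ListP.concatMap-++ g (upTo (suc m')) (suc m' ∷ [])))
                      (cong (concatMap g) (ListP.upTo-∷ʳ (suc m')))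

Pruned-map : ∀ {A B : Set} {P : A → Set} {Q : B → Set} (f : A → B) → (∀ x → P x → Q (f x)) →
             ∀ {xs ys} → Pruned P xs ys → Pruned Q (map f xs) (map f ys)
Pruned-map f P⇒Q []            = []
Pruned-map f P⇒Q (keep y p)    = keep (f y) (Pruned-map f P⇒Q p)
Pruned-map f P⇒Q (drop y Py p) = drop (f y) (P⇒Q y Py) (Pruned-map f P⇒Q p)

allBelow-pruned : ∀ {E} {Z X : ℕ^ E} → Z ≤ᵛ X → Pruned (_≰ᵛ Z) (allBelow Z) (allBelow X)
allBelow-pruned {zero}  Z≤X = keep _ []
allBelow-pruned {suc E} Z≤X =
  Pruned-concatMap-upTo _ _
    (λ a → Pruned-map (a VF.∷_) (λ { μ (e , Ze<μe) → suc e , Ze<μe }) (allBelow-pruned (Z≤X ∘ suc)))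
    (λ a Z₀<a → Pruned-[] (a VF.∷_) _ (λ _ → zero , Z₀<a))
    (Z≤X zero)

Weight : ℕ → Set
Weight E = ℕ^ E → ℕ → ℚ

𝟙 : Bool → ℚ
𝟙 b = if b then 1ℚ else 0ℚ

𝟙-∧ : ∀ b c → 𝟙 (b ∧ c) ≡ 𝟙 b * 𝟙 c
𝟙-∧ true  c = sym (ℚP.*-identityˡ (𝟙 c))
𝟙-∧ false c = sym (ℚP.*-zeroˡ (𝟙 c))

*-if-0 : ∀ b x y → x * (if b then y else 0ℚ) ≡ (if b then x * y else 0ℚ)
*-if-0 true  x y = refl
*-if-0 false x y = ℚP.*-zeroʳ x

-- decompSum w Z R Ys acc = Σ over μ ∈ {0,…,R}^Ys of Πᵢ w Yᵢ μᵢ · [acc + Σᵢ μᵢ Yᵢ = Z].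
decompSum : ∀ {E} → Weight E → ℕ^ E → ℕ → List (ℕ^ E) → ℕ^ E → ℚ
decompSum w Z R []       acc = 𝟙 (acc ≡ᵇ Z)
decompSum w Z R (Y ∷ Ys) acc =
  Σℚ (map (λ a → w Y a * decompSum w Z R Ys (acc +[ a ]· Y)) (upTo (suc R)))

module _ {E : ℕ} (w : Weight E) where

  Trivial : ℕ^ E → Set
  Trivial Y = ∀ a → w Y (suc a) ≡ 0ℚ

  decompSum-cong : ∀ {Z R} Ys {acc acc'} → (∀ e → acc e ≡ acc' e) →
                   decompSum w Z R Ys acc ≡ decompSum w Z R Ys acc'
  decompSum-cong []                acc≗acc' = cong 𝟙 (≡ᵇ-congˡ acc≗acc')
  decompSum-cong {R = R} (Y ∷ Ys) acc≗acc' = Σℚ-map-cong (upTo (suc R)) λ a →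
    cong (w Y a *_) (decompSum-cong Ys λ e → cong (ℕ._+ a ℕ.* Y e) (acc≗acc' e))

  decompSum-≰ : ∀ {Z R} Ys {acc} → acc ≰ᵛ Z → decompSum w Z R Ys acc ≡ 0ℚ
  decompSum-≰ {Z} [] {acc} (e , Ze<acce) with acc ≡ᵇ Z in acc≡ᵇZ
  ... | false = refl
  ... | true  = ⊥-elim (ℕP.<⇒≢ Ze<acce (sym (≡ᵇ-sound acc≡ᵇZ e)))
  decompSum-≰ {R = R} (Y ∷ Ys) {acc} (e , Ze<acce) = Σℚ-map-zero (upTo (suc R)) λ a →
    trans (cong (w Y a *_) (decompSum-≰ Ys (e , ℕP.<-≤-trans Ze<acce (ℕP.m≤m+n (acc e) _))))
          (ℚP.*-zeroʳ (w Y a))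

  decompSum-skip : ∀ {Z R} Y Ys {acc} → w Y 0 ≡ 1ℚ →
                   (∀ a → w Y (suc a) * decompSum w Z R Ys (acc +[ suc a ]· Y) ≡ 0ℚ) →
                   decompSum w Z R (Y ∷ Ys) acc ≡ decompSum w Z R Ys acc
  decompSum-skip {Z} {R} Y Ys {acc} w₀≡1 vanish = begin
    decompSum w Z R (Y ∷ Ys) acc                ≡⟨ Σℚ-upTo-head term R vanish ⟩
    w Y 0 * decompSum w Z R Ys (acc +[ 0 ]· Y)  ≡⟨ cong₂ _*_ w₀≡1 (decompSum-cong Ys λ e → ℕP.+-identityʳ (acc e)) ⟩
    1ℚ * decompSum w Z R Ys acc                 ≡⟨ ℚP.*-identityˡ _ ⟩
    decompSum w Z R Ys acc                      ∎
    where
    open ≡-Reasoning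
    term : ℕ → ℚ
    term a = w Y a * decompSum w Z R Ys (acc +[ a ]· Y)

  decompSum-skip-trivial : ∀ {Z R} Y Ys {acc} → w Y 0 ≡ 1ℚ → Trivial Y →
                           decompSum w Z R (Y ∷ Ys) acc ≡ decompSum w Z R Ys acc
  decompSum-skip-trivial {Z} {R} Y Ys {acc} w₀≡1 trivial = decompSum-skip Y Ys w₀≡1 λ a →
    let rest = decompSum w Z R Ys (acc +[ suc a ]· Y)
    in trans (cong (_* rest) (trivial a)) (ℚP.*-zeroˡ rest)

  decompSum-skip-≰ : ∀ {Z R} Y Ys {acc} → w Y 0 ≡ 1ℚ → Y ≰ᵛ Z →
                     decompSum w Z R (Y ∷ Ys) acc ≡ decompSum w Z R Ys acc
  decompSum-skip-≰ {Z} Y Ys {acc} w₀≡1 (e , Ze<Ye) = decompSum-skip Y Ys w₀≡1 λ a →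
    trans (cong (w Y (suc a) *_) (decompSum-≰ Ys (e , overshoot a))) (ℚP.*-zeroʳ (w Y (suc a)))
    where
    overshoot : ∀ a → Z e < (acc +[ suc a ]· Y) e
    overshoot a = ℕP.<-≤-trans Ze<Ye (ℕP.m≤n⇒m≤o+n (acc e) (ℕP.m≤m+n (Y e) (a ℕ.* Y e)))

  decompSum-range : (∀ Y → Trivial Y ⊎ ∃ λ e → 0 < Y e) →
                    ∀ {Z R R'} Ys {acc} → Σℕ Z ≤ R → R ≤ R' →
                    decompSum w Z R Ys acc ≡ decompSum w Z R' Ys acc
  decompSum-range trivial⊎nonzero []       ΣZ≤R R≤R' = refl
  decompSum-range trivial⊎nonzero {Z} {R} {R'} (Y ∷ Ys) {acc} ΣZ≤R R≤R' = begin
    Σℚ (map (λ a → w Y a * decompSum w Z R Ys (acc +[ a ]· Y)) (upTo (suc R)))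
      ≡⟨ Σℚ-map-cong (upTo (suc R)) (λ a →
           cong (w Y a *_) (decompSum-range trivial⊎nonzero Ys ΣZ≤R R≤R')) ⟩
    Σℚ (map term (upTo (suc R)))
      ≡⟨ Σℚ-upTo-extend term vanish R≤R' ⟩
    Σℚ (map term (upTo (suc R')))
      ∎
    where
    open ≡-Reasoning
    term : ℕ → ℚ
    term a = w Y a * decompSum w Z R' Ys (acc +[ a ]· Y)
    vanish : ∀ a → R < a → term a ≡ 0ℚ
    vanish (suc a) R<a with trivial⊎nonzero Y
    ... | inj₁ trivial = trans (cong (_* rest) (trivial a)) (ℚP.*-zeroˡ rest)
      where rest = decompSum w Z R' Ys (acc +[ suc a ]· Y)
    ... | inj₂ (e , 0<Ye) =
      trans (cong (w Y (suc a) *_) (decompSum-≰ Ys (e , overshoot))) (ℚP.*-zeroʳ (w Y (suc a)))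
      where
      overshoot : Z e < (acc +[ suc a ]· Y) e
      overshoot = ℕP.≤-<-trans (ℕP.≤-trans (≤Σℕ Z e) ΣZ≤R)
                    (ℕP.<-≤-trans R<a (ℕP.m≤n⇒m≤o+n (acc e) (ℕP.m≤m*n (suc a) (Y e) {{ℕ.>-nonZero 0<Ye}})))

  decompSum-prune : (∀ Y → w Y 0 ≡ 1ℚ) → ∀ {Z R Ys Ys'} → Pruned (_≰ᵛ Z) Ys Ys' →
                    ∀ acc → decompSum w Z R Ys acc ≡ decompSum w Z R Ys' acc
  decompSum-prune normalised []                   acc = refl
  decompSum-prune normalised {R = R} (keep Y p)   acc = Σℚ-map-cong (upTo (suc R)) λ a →
    cong (w Y a *_) (decompSum-prune normalised p (acc +[ a ]· Y))
  decompSum-prune normalised {Ys' = _ ∷ Ys'} (drop Y Y≰Z p) acc =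
    trans (decompSum-prune normalised p acc) (sym (decompSum-skip-≰ Y Ys' (normalised Y) Y≰Z))

  data Placement (X₁ X₂ Y : ℕ^ E) : Set where
    trivial : Trivial Y → Placement X₁ X₂ Y
    left    : Y ≼ X₁ → Y ≰ᵛ X₂ → Placement X₁ X₂ Y
    right   : Y ≼ X₂ → Y ≰ᵛ X₁ → Placement X₁ X₂ Y
    outside : Y ≰ᵛ (X₁ +ᵛ X₂) → Placement X₁ X₂ Y

  module _ {X₁ X₂ : ℕ^ E} (normalised : ∀ Y → w Y 0 ≡ 1ℚ)
           (disjoint : ∀ e → X₁ e ≡ 0 ⊎ X₂ e ≡ 0) (placement : ∀ Y → Placement X₁ X₂ Y)
           (R : ℕ) where

    private
      D D₁ D₂ : List (ℕ^ E) → ℕ^ E → ℚ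
      D  = decompSum w (X₁ +ᵛ X₂) R
      D₁ = decompSum w X₁ R
      D₂ = decompSum w X₂ R

    decompSum-+ᵛ : ∀ Ys {u₁ u₂} → u₁ ≼ X₁ → u₂ ≼ X₂ → D Ys (u₁ +ᵛ u₂) ≡ D₁ Ys u₁ * D₂ Ys u₂
    decompSum-+ᵛ [] {u₁} {u₂} u₁≼X₁ u₂≼X₂ =
      trans (cong 𝟙 (≡ᵇ-+ᵛ disjoint u₁≼X₁ u₂≼X₂)) (𝟙-∧ (u₁ ≡ᵇ X₁) (u₂ ≡ᵇ X₂))
    decompSum-+ᵛ (Y ∷ Ys) {u₁} {u₂} u₁≼X₁ u₂≼X₂ with placement Y
    ... | trivial Y-trivial = begin
      D (Y ∷ Ys) (u₁ +ᵛ u₂)             ≡⟨ decompSum-skip-trivial Y Ys (normalised Y) Y-trivial ⟩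
      D Ys (u₁ +ᵛ u₂)                   ≡⟨ decompSum-+ᵛ Ys u₁≼X₁ u₂≼X₂ ⟩
      D₁ Ys u₁ * D₂ Ys u₂               ≡⟨ sym (cong₂ _*_ (decompSum-skip-trivial Y Ys (normalised Y) Y-trivial)
                                                          (decompSum-skip-trivial Y Ys (normalised Y) Y-trivial)) ⟩
      D₁ (Y ∷ Ys) u₁ * D₂ (Y ∷ Ys) u₂   ∎
      where open ≡-Reasoning
    ... | outside Y≰X = begin
      D (Y ∷ Ys) (u₁ +ᵛ u₂)             ≡⟨ decompSum-skip-≰ Y Ys (normalised Y) Y≰X ⟩
      D Ys (u₁ +ᵛ u₂)                   ≡⟨ decompSum-+ᵛ Ys u₁≼X₁ u₂≼X₂ ⟩
      D₁ Ys u₁ * D₂ Ys u₂               ≡⟨ sym (cong₂ _*_ (decompSum-skip-≰ Y Ys (normalised Y) Y≰X₁)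
                                                          (decompSum-skip-≰ Y Ys (normalised Y) Y≰X₂)) ⟩
      D₁ (Y ∷ Ys) u₁ * D₂ (Y ∷ Ys) u₂   ∎
      where
      open ≡-Reasoning
      Y≰X₁ = ≰ᵛ-antitone (λ e → ℕP.m≤m+n (X₁ e) (X₂ e)) Y≰X
      Y≰X₂ = ≰ᵛ-antitone (λ e → ℕP.m≤n+m (X₂ e) (X₁ e)) Y≰X
    ... | left Y≼X₁ Y≰X₂ = begin
      Σℚ (map (λ a → w Y a * D Ys ((u₁ +ᵛ u₂) +[ a ]· Y)) U)
        ≡⟨ Σℚ-map-cong U (λ a → cong (w Y a *_) (trans
             (decompSum-cong Ys λ e → xy∙z≈xz∙y (u₁ e) (u₂ e) (a ℕ.* Y e))
             (decompSum-+ᵛ Ys (+[]·-≼ a u₁≼X₁ Y≼X₁) u₂≼X₂))) ⟩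
      Σℚ (map (λ a → w Y a * (D₁ Ys (u₁ +[ a ]· Y) * D₂ Ys u₂)) U)
        ≡⟨ Σℚ-map-cong U (λ a → sym (ℚP.*-assoc (w Y a) _ _)) ⟩
      Σℚ (map (λ a → (w Y a * D₁ Ys (u₁ +[ a ]· Y)) * D₂ Ys u₂) U)
        ≡⟨ Σℚ-map-*ʳ (D₂ Ys u₂) (λ a → w Y a * D₁ Ys (u₁ +[ a ]· Y)) U ⟩
      D₁ (Y ∷ Ys) u₁ * D₂ Ys u₂
        ≡⟨ cong (D₁ (Y ∷ Ys) u₁ *_) (sym (decompSum-skip-≰ Y Ys (normalised Y) Y≰X₂)) ⟩
      D₁ (Y ∷ Ys) u₁ * D₂ (Y ∷ Ys) u₂   ∎
      where
      open ≡-Reasoning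
      U = upTo (suc R)
    ... | right Y≼X₂ Y≰X₁ = begin
      Σℚ (map (λ a → w Y a * D Ys ((u₁ +ᵛ u₂) +[ a ]· Y)) U)
        ≡⟨ Σℚ-map-cong U (λ a → cong (w Y a *_) (trans
             (decompSum-cong Ys λ e → ℕP.+-assoc (u₁ e) (u₂ e) (a ℕ.* Y e))
             (decompSum-+ᵛ Ys u₁≼X₁ (+[]·-≼ a u₂≼X₂ Y≼X₂)))) ⟩
      Σℚ (map (λ a → w Y a * (D₁ Ys u₁ * D₂ Ys (u₂ +[ a ]· Y))) U)
        ≡⟨ Σℚ-map-cong U (λ a → x∙yz≈y∙xz (w Y a) (D₁ Ys u₁) _) ⟩
      Σℚ (map (λ a → D₁ Ys u₁ * (w Y a * D₂ Ys (u₂ +[ a ]· Y))) U)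
        ≡⟨ Σℚ-map-*ˡ (D₁ Ys u₁) (λ a → w Y a * D₂ Ys (u₂ +[ a ]· Y)) U ⟩
      D₁ Ys u₁ * D₂ (Y ∷ Ys) u₂
        ≡⟨ cong (_* D₂ (Y ∷ Ys) u₂) (sym (decompSum-skip-≰ Y Ys (normalised Y) Y≰X₁)) ⟩
      D₁ (Y ∷ Ys) u₁ * D₂ (Y ∷ Ys) u₂   ∎
      where
      open ≡-Reasoning
      U = upTo (suc R)

  productWeight : (Ys : List (ℕ^ E)) → (Fin (length Ys) → ℕ) → ℚ
  productWeight Ys μ = Πℚ (λ i → w (lookup Ys i) (μ i))

  Σ-multiplicities≡decompSum : ∀ Z R Ys acc →
    Σℚ (map (λ μ → if (acc +ᵛ linComb Ys μ) ≡ᵇ Z then productWeight Ys μ else 0ℚ)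
            (allFuns (length Ys) (λ _ → upTo (suc R))))
    ≡ decompSum w Z R Ys acc
  Σ-multiplicities≡decompSum Z R [] acc =
    trans (ℚP.+-identityʳ _) (cong 𝟙 (≡ᵇ-congˡ λ e → ℕP.+-identityʳ (acc e)))
  Σ-multiplicities≡decompSum Z R (Y ∷ Ys) acc = begin
    Σℚ (map term (concatMap (λ a → map (a VF.∷_) Ms) U))
      ≡⟨ Σℚ-map-concatMap term (λ a → map (a VF.∷_) Ms) U ⟩
    Σℚ (map (λ a → Σℚ (map term (map (a VF.∷_) Ms))) U)
      ≡⟨ Σℚ-map-cong U split-first ⟩
    Σℚ (map (λ a → w Y a * decompSum w Z R Ys (acc +[ a ]· Y)) U)
      ∎
    where
    open ≡-Reasoning
    U  = upTo (suc R)
    Ms = allFuns (length Ys) (λ _ → upTo (suc R))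
    term : (Fin (suc (length Ys)) → ℕ) → ℚ
    term μ = if (acc +ᵛ linComb (Y ∷ Ys) μ) ≡ᵇ Z then productWeight (Y ∷ Ys) μ else 0ℚ
    term′ : ℕ → (Fin (length Ys) → ℕ) → ℚ
    term′ a μ = if ((acc +[ a ]· Y) +ᵛ linComb Ys μ) ≡ᵇ Z then productWeight Ys μ else 0ℚ
    term-∷ : ∀ a μ → term (a VF.∷ μ) ≡ w Y a * term′ a μ
    term-∷ a μ = trans
      (cong₂ (λ b p → if b then p else 0ℚ)
             (≡ᵇ-congˡ λ e → trans (cong (acc e ℕ.+_) (Σℕ-suc (λ i → (a VF.∷ μ) i ℕ.* lookup (Y ∷ Ys) i e)))
                                   (sym (ℕP.+-assoc (acc e) _ _)))
             (Πℚ-suc (λ i → w (lookup (Y ∷ Ys) i) ((a VF.∷ μ) i))))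
      (sym (*-if-0 _ (w Y a) (productWeight Ys μ)))
    split-first : ∀ a → Σℚ (map term (map (a VF.∷_) Ms)) ≡ w Y a * decompSum w Z R Ys (acc +[ a ]· Y)
    split-first a = begin
      Σℚ (map term (map (a VF.∷_) Ms))         ≡⟨ cong Σℚ (ListP.map-∘ Ms) ⟨
      Σℚ (map (term ∘ (a VF.∷_)) Ms)           ≡⟨ Σℚ-map-cong Ms (term-∷ a) ⟩
      Σℚ (map (λ μ → w Y a * term′ a μ) Ms)    ≡⟨ Σℚ-map-*ˡ (w Y a) (term′ a) Ms ⟩
      w Y a * Σℚ (map (term′ a) Ms)            ≡⟨ cong (w Y a *_) (Σ-multiplicities≡decompSum Z R Ys (acc +[ a ]· Y)) ⟩
      w Y a * decompSum w Z R Ys (acc +[ a ]· Y) ∎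

restrict : ∀ {E} → (ℕ^ E → Bool) → Weight E → Weight E
restrict P g Y a = if P Y then g Y a else 𝟙 (isZero a)

module _ {E : ℕ} (P : ℕ^ E → Bool) (g : Weight E) where

  restrict-accept : ∀ {Y} a → P Y ≡ true → restrict P g Y a ≡ g Y a
  restrict-accept a PY rewrite PY = refl

  restrict-reject : ∀ {Y} a → P Y ≡ false → restrict P g Y a ≡ 𝟙 (isZero a)
  restrict-reject a ¬PY rewrite ¬PY = refl

  restrict-normalised : (∀ Y → g Y 0 ≡ 1ℚ) → ∀ Y → restrict P g Y 0 ≡ 1ℚ
  restrict-normalised normalised Y with P Y in PY
  ... | true  = normalised Y
  ... | false = refl

  decompSum-filterᵇ : ∀ {Z R} Ys acc →
                      decompSum g Z R (filterᵇ P Ys) acc ≡ decompSum (restrict P g) Z R Ys acc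
  decompSum-filterᵇ []                 acc = refl
  decompSum-filterᵇ {Z} {R} (Y ∷ Ys) acc = by-cases (P Y) refl
    where
    open ≡-Reasoning
    h = restrict P g
    by-cases : ∀ b → P Y ≡ b → decompSum g Z R (filterᵇ P (Y ∷ Ys)) acc ≡ decompSum h Z R (Y ∷ Ys) acc
    by-cases true PY = begin
      decompSum g Z R (filterᵇ P (Y ∷ Ys)) acc
        ≡⟨ cong (λ Ys' → decompSum g Z R Ys' acc) (ListP.filter-accept (T? ∘ P) (subst T (sym PY) tt)) ⟩
      decompSum g Z R (Y ∷ filterᵇ P Ys) acc
        ≡⟨ Σℚ-map-cong (upTo (suc R)) (λ a →
             cong₂ _*_ (sym (restrict-accept a PY)) (decompSum-filterᵇ Ys (acc +[ a ]· Y))) ⟩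
      decompSum h Z R (Y ∷ Ys) acc
        ∎
    by-cases false ¬PY = begin
      decompSum g Z R (filterᵇ P (Y ∷ Ys)) acc
        ≡⟨ cong (λ Ys' → decompSum g Z R Ys' acc) (ListP.filter-reject (T? ∘ P) (subst T ¬PY)) ⟩
      decompSum g Z R (filterᵇ P Ys) acc
        ≡⟨ decompSum-filterᵇ Ys acc ⟩
      decompSum h Z R Ys acc
        ≡⟨ decompSum-skip-trivial h Y Ys (restrict-reject 0 ¬PY) (λ a → restrict-reject (suc a) ¬PY) ⟨
      decompSum h Z R (Y ∷ Ys) acc
        ∎

not-isZero⇒>0 : ∀ {n} → not (isZero n) ≡ true → 0 < n
not-isZero⇒>0 {suc n} _ = ℕP.0<1+n

>0⇒not-isZero : ∀ {n} → 0 < n → not (isZero n) ≡ true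
>0⇒not-isZero {suc n} _ = refl

module _ {N k : ℕ} (H : Hypergraph N k) where

  VertexDisjoint : EdgeFun H → EdgeFun H → Set
  VertexDisjoint X₁ X₂ = ∀ v → v ∈V[ H ] X₁ → v ∈V[ H ] X₂ → ⊥

  edge-nonempty : 0 < k → ∀ e → Subset.Nonempty (edge H e)
  edge-nonempty 0<k e with SubsetP.nonempty? (edge H e)
  ... | yes nonempty = nonempty
  ... | no  empty    = ⊥-elim (ℕP.<⇒≢ 0<k (begin
    0                       ≡⟨ SubsetP.∣⊥∣≡0 N ⟨
    Subset.∣ Subset.⊥ {N} ∣ ≡⟨ cong Subset.∣_∣ (SubsetP.Empty-unique empty) ⟨
    Subset.∣ edge H e ∣     ≡⟨ uniform H e ⟩
    k                       ∎))
    where open ≡-Reasoning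

  vertexDisjoint⇒edgeDisjoint : 0 < k → ∀ {X₁ X₂} → VertexDisjoint X₁ X₂ → ∀ e → X₁ e ≡ 0 ⊎ X₂ e ≡ 0
  vertexDisjoint⇒edgeDisjoint 0<k {X₁} {X₂} disjoint e with X₁ e in X₁e≡ | X₂ e in X₂e≡
  ... | zero  | _     = inj₁ refl
  ... | suc _ | zero  = inj₂ refl
  ... | suc _ | suc _ =
    let v , v∈e = edge-nonempty 0<k e
    in ⊥-elim (disjoint v (e , subst (0 <_) (sym X₁e≡) ℕP.0<1+n , v∈e)
                          (e , subst (0 <_) (sym X₂e≡) ℕP.0<1+n , v∈e))

  connected⇒nonzero : ∀ {Y} → isConnectedᵇ H Y ≡ true → ∃ λ e → 0 < Y e
  connected⇒nonzero {Y} connected =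
    let e , Ye≢0 = any-tabulate⁻ (λ e → not (isZero (Y e))) id (BoolP.∧-conicalˡ _ _ connected)
    in e , not-isZero⇒>0 Ye≢0

  inVᵇ-intro : ∀ {Y v} e → 0 < Y e → v ∈ edge H e → inVᵇ H Y v ≡ true
  inVᵇ-intro e 0<Ye v∈e = any-tabulate⁺ _ id e (cong₂ _∧_ (>0⇒not-isZero 0<Ye) (VecP.[]=⇒lookup v∈e))

  connected⇒reach : ∀ {Y u w} → isConnectedᵇ H Y ≡ true →
                    inVᵇ H Y u ≡ true → inVᵇ H Y w ≡ true → reach H Y u w ≡ true
  connected⇒reach {Y} {u} {w} connected u∈Y w∈Y =
    subst (λ b → not b ∨ reach H Y u w ≡ true) (cong₂ _∧_ u∈Y w∈Y)
      (all-tabulate⁻ _ id (all-tabulate⁻ _ id (BoolP.∧-conicalʳ _ _ connected) u) w)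

  module _ (Y : EdgeFun H) (Q : Fin N → Set)
           (closed : ∀ f {u w} → 0 < Y f → u ∈ edge H f → w ∈ edge H f → Q u → Q w) where

    private
      Within : (Fin N → Bool) → Set
      Within R = ∀ w → R w ≡ true → Q w

      reachStep-within : ∀ {R} → Within R → Within (reachStep H Y R)
      reachStep-within {R} R⊆Q w step with R w in Rw
      ... | true  = R⊆Q w Rw
      ... | false = closed f (not-isZero⇒>0 Yf≢0) (VecP.lookup⇒[]= u (edge H f) u∈f)
                             (VecP.lookup⇒[]= w (edge H f) w∈f) (R⊆Q u Ru)
        where
        meets : Fin (nEdges H) → Fin N → Bool
        meets f u = R u ∧ inE u (edge H f)
        f-step = any-tabulate⁻ (λ f → not (isZero (Y f)) ∧ inE w (edge H f) ∧ any (meets f) (allFin N)) id step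
        f      = proj₁ f-step
        wf     = inE w (edge H f)
        meetsf = any (meets f) (allFin N)
        Yf≢0   = BoolP.∧-conicalˡ (not (isZero (Y f))) (wf ∧ meetsf) (proj₂ f-step)
        w-rest = BoolP.∧-conicalʳ (not (isZero (Y f))) (wf ∧ meetsf) (proj₂ f-step)
        w∈f    = BoolP.∧-conicalˡ wf meetsf w-rest
        u-step = any-tabulate⁻ (meets f) id (BoolP.∧-conicalʳ wf meetsf w-rest)
        u      = proj₁ u-step
        Ru     = BoolP.∧-conicalˡ (R u) (inE u (edge H f)) (proj₂ u-step)
        u∈f    = BoolP.∧-conicalʳ (R u) (inE u (edge H f)) (proj₂ u-step)

      iterate-within : ∀ m {R} → Within R → Within (iter m (reachStep H Y) R)
      iterate-within zero    R⊆Q = R⊆Q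
      iterate-within (suc m) R⊆Q = reachStep-within (iterate-within m R⊆Q)

    reach-closed : ∀ {u w} → reach H Y u w ≡ true → Q u → Q w
    reach-closed {u} {w} u⇝w Qu = iterate-within (nEdges H) start w u⇝w
      where
      start : Within (u ==ᶠ_)
      start w u≡w with u FinP.≟ w
      start w u≡w  | yes refl = Qu
      start w ()   | no _

  module _ (0<k : 0 < k) {X₁ X₂ : EdgeFun H} (disjoint : VertexDisjoint X₁ X₂) where

    connected-≼-+ᵛ : ∀ {Y} → isConnectedᵇ H Y ≡ true → Y ≼ (X₁ +ᵛ X₂) → Y ≼ X₁ ⊎ Y ≼ X₂
    connected-≼-+ᵛ {Y} connected Y≼X with ≼⊎escapes Y X₁ | ≼⊎escapes Y X₂
    ... | inj₁ Y≼X₁ | _         = inj₁ Y≼X₁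
    ... | inj₂ _    | inj₁ Y≼X₂ = inj₂ Y≼X₂
    ... | inj₂ (e₁ , 0<Ye₁ , X₁e₁≡0) | inj₂ (e₂ , 0<Ye₂ , X₂e₂≡0) = ⊥-elim (disjoint w w∈X₁ w∈X₂)
      where
      u = proj₁ (edge-nonempty 0<k e₁)
      w = proj₁ (edge-nonempty 0<k e₂)
      u∈X₂ : u ∈V[ H ] X₂
      u∈X₂ = e₁ , [ (λ 0<X₁e₁ → ⊥-elim (ℕP.<⇒≢ 0<X₁e₁ (sym X₁e₁≡0))) , id ]′ (≼-+ᵛ⁻ X₁ X₂ Y≼X 0<Ye₁)
                , proj₂ (edge-nonempty 0<k e₁)
      w∈X₁ : w ∈V[ H ] X₁
      w∈X₁ = e₂ , [ id , (λ 0<X₂e₂ → ⊥-elim (ℕP.<⇒≢ 0<X₂e₂ (sym X₂e₂≡0))) ]′ (≼-+ᵛ⁻ X₁ X₂ Y≼X 0<Ye₂)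
                , proj₂ (edge-nonempty 0<k e₂)
      -- Walking along edges of Y never leaves V(X₂): such an edge lies in X₁ or X₂, and
      -- an edge of X₁ through a vertex of V(X₂) would contradict vertex-disjointness.
      stays-in-X₂ : ∀ f {u w} → 0 < Y f → u ∈ edge H f → w ∈ edge H f → u ∈V[ H ] X₂ → w ∈V[ H ] X₂
      stays-in-X₂ f 0<Yf u∈f w∈f u∈X₂ with ≼-+ᵛ⁻ X₁ X₂ Y≼X 0<Yf
      ... | inj₁ 0<X₁f = ⊥-elim (disjoint _ (f , 0<X₁f , u∈f) u∈X₂)
      ... | inj₂ 0<X₂f = f , 0<X₂f , w∈f
      w∈X₂ : w ∈V[ H ] X₂
      w∈X₂ = reach-closed Y (_∈V[ H ] X₂) stays-in-X₂
               (connected⇒reach connected (inVᵇ-intro e₁ 0<Ye₁ (proj₂ (edge-nonempty 0<k e₁)))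
                                          (inVᵇ-intro e₂ 0<Ye₂ (proj₂ (edge-nonempty 0<k e₂))))
               u∈X₂

  isComponentᵇ : EdgeFun H → Bool
  isComponentᵇ Y = isInfragraphᵇ H Y ∧ isConnectedᵇ H Y

  component⇒connected : ∀ {Y} → isComponentᵇ Y ≡ true → isConnectedᵇ H Y ≡ true
  component⇒connected {Y} = BoolP.∧-conicalʳ (isInfragraphᵇ H Y) (isConnectedᵇ H Y)

  module _ (g : Weight (nEdges H)) where

    component-trivial⊎nonzero : ∀ Y → Trivial (restrict isComponentᵇ g) Y ⊎ ∃ λ e → 0 < Y e
    component-trivial⊎nonzero Y = by-cases (isComponentᵇ Y) refl
      where
      by-cases : ∀ b → isComponentᵇ Y ≡ b → Trivial (restrict isComponentᵇ g) Y ⊎ ∃ λ e → 0 < Y e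
      by-cases true  component     = inj₂ (connected⇒nonzero (component⇒connected component))
      by-cases false not-component = inj₁ λ a → restrict-reject isComponentᵇ g (suc a) not-component

    component-placement : 0 < k → ∀ {X₁ X₂} → VertexDisjoint X₁ X₂ →
                          ∀ Y → Placement (restrict isComponentᵇ g) X₁ X₂ Y
    component-placement 0<k {X₁} {X₂} disjoint Y = by-cases (isComponentᵇ Y) refl
      where
      edge-disjoint = vertexDisjoint⇒edgeDisjoint 0<k disjoint
      by-cases : ∀ b → isComponentᵇ Y ≡ b → Placement (restrict isComponentᵇ g) X₁ X₂ Y
      by-cases false not-component = trivial λ a → restrict-reject isComponentᵇ g (suc a) not-component
      by-cases true  component     = place (≼⊎escapes Y (X₁ +ᵛ X₂))
        where
        connected = component⇒connected component
        nonzero   = connected⇒nonzero connected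
        place : Y ≼ (X₁ +ᵛ X₂) ⊎ (∃ λ e → 0 < Y e × (X₁ +ᵛ X₂) e ≡ 0) →
                Placement (restrict isComponentᵇ g) X₁ X₂ Y
        place (inj₂ (e , 0<Ye , Xe≡0)) = outside (e , subst (_< Y e) (sym Xe≡0) 0<Ye)
        place (inj₁ Y≼X) =
          [ (λ Y≼X₁ → left  Y≼X₁ (≼-disjoint⇒≰ᵛ edge-disjoint nonzero Y≼X₁))
          , (λ Y≼X₂ → right Y≼X₂ (≼-disjoint⇒≰ᵛ (swap ∘ edge-disjoint) nonzero Y≼X₂))
          ]′ (connected-≼-+ᵛ 0<k disjoint connected Y≼X)

  -- In Δ(n, X), each of the a copies of a component Y in a decomposition S contributes
  -- −(k−1)ⁿ C_Y, and 1/a! is the share of α_S belonging to Y.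
  componentWeight : ℕ → Weight (nEdges H)
  componentWeight n Y a = ((ℚ.- ℕ→ℚ ((k ℕ.∸ 1) ℕ.^ n)) ^ℚ a * C H Y ^ℚ a) * inv! a

  decompositionWeight : ℕ → Weight (nEdges H)
  decompositionWeight n = restrict isComponentᵇ (componentWeight n)

  decompositionWeight-normalised : ∀ n Y → decompositionWeight n Y 0 ≡ 1ℚ
  decompositionWeight-normalised n = restrict-normalised isComponentᵇ (componentWeight n) (λ _ → refl)

  Δ-summand≡productWeight : ∀ n Ys (μ : Fin (length Ys) → ℕ) →
    ((ℚ.- ℕ→ℚ ((k ℕ.∸ 1) ℕ.^ n)) ^ℚ Σℕ μ * Πℚ (λ i → C H (lookup Ys i) ^ℚ μ i)) * Πℚ (λ i → inv! (μ i))
    ≡ productWeight (componentWeight n) Ys μ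
  Δ-summand≡productWeight n Ys μ = begin
    (q ^ℚ Σℕ μ * Πℚ Cᵘ) * Πℚ inv!ᵘ                  ≡⟨ cong (λ x → (x * Πℚ Cᵘ) * Πℚ inv!ᵘ) (^ℚ-Σℕ q μ) ⟩
    (Πℚ qᵘ * Πℚ Cᵘ) * Πℚ inv!ᵘ                      ≡⟨ cong (_* Πℚ inv!ᵘ) (Πℚ-* qᵘ Cᵘ) ⟨
    Πℚ (λ i → qᵘ i * Cᵘ i) * Πℚ inv!ᵘ               ≡⟨ Πℚ-* (λ i → qᵘ i * Cᵘ i) inv!ᵘ ⟨
    Πℚ (λ i → (qᵘ i * Cᵘ i) * inv!ᵘ i)              ∎
    where
    open ≡-Reasoning
    q = ℚ.- ℕ→ℚ ((k ℕ.∸ 1) ℕ.^ n)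
    qᵘ Cᵘ inv!ᵘ : Fin (length Ys) → ℚ
    qᵘ    i = q ^ℚ μ i
    Cᵘ    i = C H (lookup Ys i) ^ℚ μ i
    inv!ᵘ i = inv! (μ i)

  Δ≡decompSum : ∀ n X → Δ H n X ≡ decompSum (decompositionWeight n) X (Σℕ X) (allBelow X) 0ᵛ
  Δ≡decompSum n X = begin
    Δ H n X
      ≡⟨ Σℚ-map-filterᵇ summand (λ μ → linComb cs μ ≡ᵇ X) Ms ⟩
    Σℚ (map (λ μ → if linComb cs μ ≡ᵇ X then summand μ else 0ℚ) Ms)
      ≡⟨ Σℚ-map-cong Ms (λ μ → cong (λ x → if linComb cs μ ≡ᵇ X then x else 0ℚ) (Δ-summand≡productWeight n cs μ)) ⟩
    Σℚ (map (λ μ → if (0ᵛ +ᵛ linComb cs μ) ≡ᵇ X then productWeight (componentWeight n) cs μ else 0ℚ) Ms)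
      ≡⟨ Σ-multiplicities≡decompSum (componentWeight n) X (Σℕ X) cs 0ᵛ ⟩
    decompSum (componentWeight n) X (Σℕ X) (filterᵇ isComponentᵇ (allBelow X)) 0ᵛ
      ≡⟨ decompSum-filterᵇ isComponentᵇ (componentWeight n) (allBelow X) 0ᵛ ⟩
    decompSum (decompositionWeight n) X (Σℕ X) (allBelow X) 0ᵛ
      ∎
    where
    open ≡-Reasoning
    cs = candidates H X
    Ms = allFuns (length cs) (λ _ → upTo (suc (Σℕ X)))
    summand : (Fin (length cs) → ℕ) → ℚ
    summand μ = (ℚ.- ℕ→ℚ ((k ℕ.∸ 1) ℕ.^ n)) ^ℚ Σℕ μ * Πℚ (λ i → C H (lookup cs i) ^ℚ μ i)
                * Πℚ (λ i → inv! (μ i))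

  Δ≡decompSum-below : ∀ n {Z X} R → Z ≤ᵛ X → Σℕ Z ≤ R →
                      Δ H n Z ≡ decompSum (decompositionWeight n) Z R (allBelow X) 0ᵛ
  Δ≡decompSum-below n {Z} {X} R Z≤X ΣZ≤R = begin
    Δ H n Z                                   ≡⟨ Δ≡decompSum n Z ⟩
    decompSum h Z (Σℕ Z) (allBelow Z) 0ᵛ      ≡⟨ decompSum-range h (component-trivial⊎nonzero (componentWeight n))
                                                                   (allBelow Z) ℕP.≤-refl ΣZ≤R ⟩
    decompSum h Z R (allBelow Z) 0ᵛ           ≡⟨ decompSum-prune h (decompositionWeight-normalised n)
                                                                   (allBelow-pruned Z≤X) 0ᵛ ⟩
    decompSum h Z R (allBelow X) 0ᵛ           ∎
    where
    open ≡-Reasoning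
    h = decompositionWeight n

mainTheorem3 : ∀ {N k : ℕ} → 2 ≤ k → (H : Hypergraph N k) → (X₁ X₂ : EdgeFun H) →
    IsInfragraph H X₁ → IsInfragraph H X₂ →
    (∀ (v : Fin N) → v ∈V[ H ] X₁ → v ∈V[ H ] X₂ → ⊥) →
    ∀ (n : ℕ) → Δ H n (_⊕_ {H = H} X₁ X₂) ≡ Δ H n X₁ * Δ H n X₂
mainTheorem3 2≤k H X₁ X₂ _ _ disjoint n = begin
  Δ H n X                                       ≡⟨ Δ≡decompSum-below H n R (λ _ → ℕP.≤-refl) ℕP.≤-refl ⟩
  D X                                           ≡⟨ decompSum-+ᵛ h (decompositionWeight-normalised H n)
                                                     (vertexDisjoint⇒edgeDisjoint H 0<k disjoint)
                                                     (component-placement H (componentWeight H n) 0<k disjoint)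
                                                     R (allBelow X) (λ _ _ → refl) (λ _ _ → refl) ⟩
  D X₁ * D X₂                                   ≡⟨ cong₂ _*_ (Δ≡decompSum-below H n R X₁≤X (Σℕ-mono-≤ᵛ X₁≤X))
                                                             (Δ≡decompSum-below H n R X₂≤X (Σℕ-mono-≤ᵛ X₂≤X)) ⟨
  Δ H n X₁ * Δ H n X₂                           ∎
  where
  -- Δ is defined for arbitrary edge functions.
  open ≡-Reasoning
  0<k = ℕP.<-≤-trans ℕP.0<1+n 2≤k
  X   = X₁ +ᵛ X₂
  R   = Σℕ X
  h   = decompositionWeight H n
  D : EdgeFun H → ℚ
  D Z = decompSum h Z R (allBelow X) 0ᵛ
  X₁≤X : X₁ ≤ᵛ X
  X₁≤X e = ℕP.m≤m+n (X₁ e) (X₂ e)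
  X₂≤X : X₂ ≤ᵛ X
  X₂≤X e = ℕP.m≤n+m (X₂ e) (X₁ e)
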